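{- If $G$ is a good graph with $\omega(G)=4$, then $G$ is $4$-colorable.
   Context: All graphs are finite and simple; $\omega$ denotes the clique number. For vertex sets $A,B$ of $G$, the edge set $[A,B]$ is special if each vertex of $A$ is adjacent to at most one vertex of $B$ and each vertex of $B$ is adjacent to at most one vertex of $A$. A pair $\{A,B\}$ is graded if $A$ and $B$ are cliques and $[A,B]$ is special. A graph $G$ is a good graph if $V(G)$ can be partitioned into three cliques $Q_1,Q_2,Q_3$ such that $\{Q_1,Q_2\}$, $\{Q_2,Q_3\}$ and $\{Q_3,Q_1\}$ are graded. -}

module Defs where

open import Data.Nat using (ℕ; _≤_)
open import Data.Fin using (Fin)
open import Data.Fin.Subset using (Subset; _∈_; ∣_∣)
open import Data.Bool using (Bool; true)
open import Data.Product using (Σ; _×_; ∃)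
open import Relation.Binary.PropositionalEquality using (_≡_; _≢_)
open import Relation.Nullary using (¬_)
open import Data.Sum using (_⊎_)
open import Data.Empty using (⊥)

record Graph (n : ℕ) : Set where
  field
    adj    : Fin n → Fin n → Bool
    sym    : ∀ u v → adj u v ≡ true → adj v u ≡ true
    irrefl : ∀ v → ¬ (adj v v ≡ true)

module _ {n : ℕ} (G : Graph n) where
  open Graph G

  Adj : Fin n → Fin n → Set
  Adj u v = adj u v ≡ true

  IsClique : Subset n → Set
  IsClique S = ∀ u v → u ∈ S → v ∈ S → u ≢ v → Adj u v

  CliqueNumber : ℕ → Set
  CliqueNumber k =
    (Σ (Subset n) λ S → IsClique S × ∣ S ∣ ≡ k)
    × (∀ S → IsClique S → ∣ S ∣ ≤ k)

  Special : Subset n → Subset n → Set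
  Special A B =
    (∀ a b b′ → a ∈ A → b ∈ B → b′ ∈ B → Adj a b → Adj a b′ → b ≡ b′)
    × (∀ b a a′ → b ∈ B → a ∈ A → a′ ∈ A → Adj b a → Adj b a′ → a ≡ a′)

  Graded : Subset n → Subset n → Set
  Graded A B = IsClique A × IsClique B × Special A B

  IsPartition3 : Subset n → Subset n → Subset n → Set
  IsPartition3 Q₁ Q₂ Q₃ =
    (∀ v → v ∈ Q₁ ⊎ v ∈ Q₂ ⊎ v ∈ Q₃)
    × (∀ v → v ∈ Q₁ → v ∈ Q₂ → ⊥)
    × (∀ v → v ∈ Q₂ → v ∈ Q₃ → ⊥)
    × (∀ v → v ∈ Q₃ → v ∈ Q₁ → ⊥)

  Good : Set
  Good = Σ (Subset n) λ Q₁ → Σ (Subset n) λ Q₂ → Σ (Subset n) λ Q₃ →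
    IsPartition3 Q₁ Q₂ Q₃ × Graded Q₁ Q₂ × Graded Q₂ Q₃ × Graded Q₃ Q₁

  Colorable : ℕ → Set
  Colorable k = Σ (Fin n → Fin k) λ c → ∀ u v → Adj u v → c u ≢ c v

module Submission where

-- Colour Q₁ by the positions of its vertices, and Q₂, then Q₃, by their positions composed with
-- a permutation σ of Fin 4. The edges between two cliques form a matching, so each vertex of Q₂
-- has at most one forbidden colour and each colour is forbidden for at most one vertex of Q₂;
-- for Q₃ these bounds become two. A permutation of Fin 4 avoiding a relation with at most two
-- entries in every row and column exists: repair any permutation row by row, swapping a bad
-- row i with a row j that owns one of the two free columns of i and does not forbid σ i.

open import Defs
open import Level using (0ℓ)
open import Data.Nat using (ℕ; suc; _≤_; _<_; z≤n; s≤s; NonZero)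
open import Data.Nat.Properties using (≤-trans; suc-injective)
open import Data.Nat.DivMod using (_mod_; _%_; m<n⇒m%n≡m)
open import Data.Fin using (Fin; zero; suc; toℕ; _≟_)
open import Data.Fin.Properties using (any?; toℕ-fromℕ<)
open import Data.Fin.Permutation using (Permutation′; _⟨$⟩ʳ_; _⟨$⟩ˡ_; inverseʳ; transpose; _∘ₚ_; id) renaming (flip to flip′)
import Data.Fin.Permutation.Components as PC
open import Data.Fin.Patterns using (0F; 1F; 2F; 3F)
open import Data.Fin.Subset using (Subset; _∈_; ∣_∣)
open import Data.Fin.Subset.Properties using (_∈?_)
open import Data.Vec using (_∷_; here; there)
open import Data.Bool using (true; false) renaming (_≟_ to _≟ᵇ_)
open import Data.List using (List; []; _∷_; allFin)
open import Data.List.Relation.Unary.All as All using (All; []; _∷_)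
open import Data.List.Membership.Propositional.Properties using (∈-allFin)
open import Data.Product using (Σ-syntax; ∃; ∃₂; _×_; _,_; proj₁; proj₂; swap; map₂)
open import Data.Sum using (_⊎_; inj₁; inj₂)
open import Data.Empty using (⊥; ⊥-elim)
open import Function using (flip; _∘_)
open import Function.Bundles using (Injection)
open import Function.Properties.Inverse using (↔⇒↣)
open import Relation.Nullary using (¬_; yes; no)
open import Relation.Nullary.Decidable using (_×-dec_)
open import Relation.Unary as U using (Pred; _∪_)
open import Relation.Binary using (Rel)
open import Relation.Binary.Definitions using (Decidable)
import Relation.Binary.Construct.Union as Union
open import Relation.Binary.PropositionalEquality using (_≡_; _≢_; refl; sym; cong; subst; module ≡-Reasoning)

AtMostOne : {A : Set} → Pred A 0ℓ → Set
AtMostOne P = ∀ {x y} → P x → P y → x ≡ y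

AtMostTwo : {A : Set} → Pred A 0ℓ → Set
AtMostTwo P = ∀ {x y z} → x ≢ y → x ≢ z → y ≢ z → P x → P y → P z → ⊥

atMostOne⇒atMostTwo : {A : Set} {P : Pred A 0ℓ} → AtMostOne P → AtMostTwo P
atMostOne⇒atMostTwo one x≢y _ _ px py _ = x≢y (one px py)

module _ {A : Set} {P Q : Pred A 0ℓ} where

  atMostOne-∪ : AtMostOne P → AtMostOne Q → AtMostTwo (P ∪ Q)
  atMostOne-∪ p q x≢y _   _   (inj₁ a) (inj₁ b) _        = x≢y (p a b)
  atMostOne-∪ p q x≢y _   _   (inj₂ a) (inj₂ b) _        = x≢y (q a b)
  atMostOne-∪ p q _   x≢z _   (inj₁ a) (inj₂ _) (inj₁ c) = x≢z (p a c)
  atMostOne-∪ p q _   _   y≢z (inj₁ _) (inj₂ b) (inj₂ c) = y≢z (q b c)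
  atMostOne-∪ p q _   _   y≢z (inj₂ _) (inj₁ b) (inj₁ c) = y≢z (p b c)
  atMostOne-∪ p q _   x≢z _   (inj₂ a) (inj₁ _) (inj₂ c) = x≢z (q a c)

TwoOutside : {A : Set} → Pred A 0ℓ → Set
TwoOutside P = ∃₂ λ y y′ → y ≢ y′ × ¬ P y × ¬ P y′

atMostTwo⇒twoOutside₄ : {P : Pred (Fin 4) 0ℓ} → U.Decidable P → AtMostTwo P → TwoOutside P
atMostTwo⇒twoOutside₄ P? two with P? 0F | P? 1F | P? 2F | P? 3F
... | no p₀  | no p₁  | _      | _      = _ , _ , (λ ()) , p₀ , p₁
... | no p₀  | yes _  | no p₂  | _      = _ , _ , (λ ()) , p₀ , p₂
... | no p₀  | yes _  | yes _  | no p₃  = _ , _ , (λ ()) , p₀ , p₃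
... | no _   | yes p₁ | yes p₂ | yes p₃ = ⊥-elim (two (λ ()) (λ ()) (λ ()) p₁ p₂ p₃)
... | yes _  | no p₁  | no p₂  | _      = _ , _ , (λ ()) , p₁ , p₂
... | yes _  | no p₁  | yes _  | no p₃  = _ , _ , (λ ()) , p₁ , p₃
... | yes p₀ | no _   | yes p₂ | yes p₃ = ⊥-elim (two (λ ()) (λ ()) (λ ()) p₀ p₂ p₃)
... | yes _  | yes _  | no p₂  | no p₃  = _ , _ , (λ ()) , p₂ , p₃
... | yes p₀ | yes p₁ | no _   | yes p₃ = ⊥-elim (two (λ ()) (λ ()) (λ ()) p₀ p₁ p₃)
... | yes p₀ | yes p₁ | yes p₂ | _      = ⊥-elim (two (λ ()) (λ ()) (λ ()) p₀ p₁ p₂)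

transpose-cases : ∀ {n} (i j k : Fin n) →
  (k ≡ i × PC.transpose i j k ≡ j) ⊎ (k ≡ j × PC.transpose i j k ≡ i) ⊎
  (k ≢ i × k ≢ j × PC.transpose i j k ≡ k)
transpose-cases i j k with k ≟ i
... | yes k≡i = inj₁ (k≡i , refl)
... | no k≢i with k ≟ j
...   | yes k≡j = inj₂ (inj₁ (k≡j , refl))
...   | no k≢j  = inj₂ (inj₂ (k≢i , k≢j , refl))

permutation-injective : ∀ {n} (σ : Permutation′ n) {i j} → σ ⟨$⟩ʳ i ≡ σ ⟨$⟩ʳ j → i ≡ j
permutation-injective σ = Injection.injective (↔⇒↣ σ)

module _ {n : ℕ} (R : Rel (Fin n) 0ℓ) where

  AvoidsAt : Permutation′ n → Fin n → Set
  AvoidsAt σ i = ¬ R i (σ ⟨$⟩ʳ i)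

  Avoids : Permutation′ n → Set
  Avoids σ = ∀ i → AvoidsAt σ i

  Improves : Permutation′ n → Permutation′ n → Set
  Improves σ σ′ = ∀ r → AvoidsAt σ r → AvoidsAt σ′ r

module _ {n : ℕ} {R : Rel (Fin n) 0ℓ} where

  swap-improves : (σ : Permutation′ n) {i j : Fin n} →
    ¬ R i (σ ⟨$⟩ʳ j) → ¬ R j (σ ⟨$⟩ʳ i) →
    Σ[ σ′ ∈ Permutation′ n ] Improves R σ σ′ × AvoidsAt R σ′ i
  swap-improves σ {i} {j} i↛σj j↛σi =
    transpose i j ∘ₚ σ , (λ r ok → swapped r (λ _ _ → ok)) , swapped i (λ i≢i _ → ⊥-elim (i≢i refl))
    where
    swapped : ∀ r → (r ≢ i → r ≢ j → AvoidsAt R σ r) → AvoidsAt R (transpose i j ∘ₚ σ) r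
    swapped r ok with transpose-cases i j r
    ... | inj₁ (refl , e)        = subst (λ x → ¬ R r (σ ⟨$⟩ʳ x)) (sym e) i↛σj
    ... | inj₂ (inj₁ (refl , e)) = subst (λ x → ¬ R r (σ ⟨$⟩ʳ x)) (sym e) j↛σi
    ... | inj₂ (inj₂ (r≢i , r≢j , e)) = subst (λ x → ¬ R r (σ ⟨$⟩ʳ x)) (sym e) (ok r≢i r≢j)

  preimage-free : (σ : Permutation′ n) {i z : Fin n} → ¬ R i z → ¬ R i (σ ⟨$⟩ʳ (σ ⟨$⟩ˡ z))
  preimage-free σ {i} i↛z = subst (λ x → ¬ R i x) (sym (inverseʳ σ)) i↛z

  bad-row≢preimage : (σ : Permutation′ n) {i z : Fin n} → R i (σ ⟨$⟩ʳ i) → ¬ R i z → i ≢ σ ⟨$⟩ˡ z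
  bad-row≢preimage σ bad i↛z refl = preimage-free σ i↛z bad

  module _ (R? : Decidable R) (col : ∀ x → AtMostTwo (flip R x)) where

    -- Swap row i with the row j = σ⁻¹ y owning a free column y of row i. Column σ i already
    -- forbids row i, hence at most one of the two candidates for j; take the other one.
    repair-at : (σ : Permutation′ n) {i y y′ : Fin n} →
      R i (σ ⟨$⟩ʳ i) → y ≢ y′ → ¬ R i y → ¬ R i y′ →
      Σ[ σ′ ∈ Permutation′ n ] Improves R σ σ′ × AvoidsAt R σ′ i
    repair-at σ {i} {y} {y′} bad y≢y′ i↛y i↛y′ with R? (σ ⟨$⟩ˡ y) (σ ⟨$⟩ʳ i)
    ... | no j↛σi  = swap-improves σ (preimage-free σ i↛y) j↛σi
    ... | yes j→σi = swap-improves σ (preimage-free σ i↛y′) λ j′→σi →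
      col (σ ⟨$⟩ʳ i) (bad-row≢preimage σ bad i↛y) (bad-row≢preimage σ bad i↛y′)
          (y≢y′ ∘ permutation-injective (flip′ σ)) bad j→σi j′→σi

    module _ (row : ∀ i → TwoOutside (R i)) where

      repair : (σ : Permutation′ n) (i : Fin n) →
        Σ[ σ′ ∈ Permutation′ n ] Improves R σ σ′ × AvoidsAt R σ′ i
      repair σ i with R? i (σ ⟨$⟩ʳ i) | row i
      ... | no ok   | _ = σ , (λ _ ok′ → ok′) , ok
      ... | yes bad | _ , _ , y≢y′ , i↛y , i↛y′ = repair-at σ bad y≢y′ i↛y i↛y′

      repair-all : (rows : List (Fin n)) → Σ[ σ ∈ Permutation′ n ] All (AvoidsAt R σ) rows
      repair-all [] = id , []
      repair-all (i ∷ rows) with repair-all rows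
      ... | σ , ok with repair σ i
      ...   | σ′ , improves , ok-i = σ′ , ok-i ∷ All.map (improves _) ok

      avoiding-permutation : ∃ (Avoids R)
      avoiding-permutation with repair-all (allFin n)
      ... | σ , ok = σ , λ i → All.lookup ok (∈-allFin i)

avoiding-permutation₄ : {R : Rel (Fin 4) 0ℓ} → Decidable R →
  (∀ i → AtMostTwo (R i)) → (∀ x → AtMostTwo (flip R x)) → ∃ (Avoids R)
avoiding-permutation₄ R? row col =
  avoiding-permutation R? col (λ i → atMostTwo⇒twoOutside₄ (R? i) (row i))

rank : ∀ {n} → Subset n → Fin n → ℕ
rank (_     ∷ p) zero    = 0
rank (true  ∷ p) (suc i) = suc (rank p i)
rank (false ∷ p) (suc i) = rank p i

rank<∣p∣ : ∀ {n} (p : Subset n) {i : Fin n} → i ∈ p → rank p i < ∣ p ∣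
rank<∣p∣ (true  ∷ p) here      = s≤s z≤n
rank<∣p∣ (true  ∷ p) (there i) = s≤s (rank<∣p∣ p i)
rank<∣p∣ (false ∷ p) (there i) = rank<∣p∣ p i

rank-injective : ∀ {n} (p : Subset n) {i j : Fin n} → i ∈ p → j ∈ p → rank p i ≡ rank p j → i ≡ j
rank-injective (_     ∷ p) {zero}  {zero}  _         _         _ = refl
rank-injective (true  ∷ p) {zero}  {suc j} _         _         ()
rank-injective (true  ∷ p) {suc i} {zero}  _         _         ()
rank-injective (true  ∷ p) {suc i} {suc j} (there i∈p) (there j∈p) e =
  cong suc (rank-injective p i∈p j∈p (suc-injective e))
rank-injective (false ∷ p) {suc i} {suc j} (there i∈p) (there j∈p) e =
  cong suc (rank-injective p i∈p j∈p e)

mod-injective : ∀ {m m′ k} .{{_ : NonZero k}} → m < k → m′ < k → m mod k ≡ m′ mod k → m ≡ m′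
mod-injective {m} {m′} {k} m<k m′<k e = begin
  m             ≡⟨ sym (m<n⇒m%n≡m m<k) ⟩
  m % k         ≡⟨ sym (toℕ-fromℕ< _) ⟩
  toℕ (m mod k)  ≡⟨ cong toℕ e ⟩
  toℕ (m′ mod k) ≡⟨ toℕ-fromℕ< _ ⟩
  m′ % k        ≡⟨ m<n⇒m%n≡m m′<k ⟩
  m′            ∎
  where open ≡-Reasoning

-- Meaningful only for i ∈ p and ∣ p ∣ ≤ k; otherwise the rank may wrap around.
label : ∀ {n} (k : ℕ) .{{_ : NonZero k}} → Subset n → Fin n → Fin k
label k p i = rank p i mod k

InjectiveOn : ∀ {n} {B : Set} → Subset n → (Fin n → B) → Set
InjectiveOn S c = ∀ {u v} → u ∈ S → v ∈ S → c u ≡ c v → u ≡ v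

label-injective : ∀ {n k} .{{_ : NonZero k}} (p : Subset n) → ∣ p ∣ ≤ k → InjectiveOn p (label k p)
label-injective p ∣p∣≤k i∈p j∈p e = rank-injective p i∈p j∈p
  (mod-injective (≤-trans (rank<∣p∣ p i∈p) ∣p∣≤k) (≤-trans (rank<∣p∣ p j∈p) ∣p∣≤k) e)

relabel : ∀ {n} → Permutation′ 4 → Subset n → Fin n → Fin 4
relabel σ T w = σ ⟨$⟩ʳ label 4 T w

relabel-injective : ∀ {n} (σ : Permutation′ 4) (T : Subset n) → ∣ T ∣ ≤ 4 →
  InjectiveOn T (relabel σ T)
relabel-injective σ T ∣T∣≤4 u∈T v∈T = label-injective T ∣T∣≤4 u∈T v∈T ∘ permutation-injective σ

module _ {n : ℕ} (G : Graph n) where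
  open Graph G using (adj; irrefl) renaming (sym to adj-sym)

  Separated : {k : ℕ} → Subset n → Subset n → (Fin n → Fin k) → (Fin n → Fin k) → Set
  Separated S T cS cT = ∀ {u w} → u ∈ S → w ∈ T → Adj G u w → cS u ≢ cT w

  separated-sym : ∀ {k S T} {cS cT : Fin n → Fin k} → Separated S T cS cT → Separated T S cT cS
  separated-sym sep w∈T u∈S w~u = sep u∈S w∈T (adj-sym _ _ w~u) ∘ sym

  injectiveOn⇒separated : ∀ {k S} {c : Fin n → Fin k} → InjectiveOn S c → Separated S S c c
  injectiveOn⇒separated inj u∈S v∈S u~v e with inj u∈S v∈S e
  ... | refl = irrefl _ u~v

  module _ (S T : Subset n) (cS : Fin n → Fin 4) where

    -- The row c of the permutation problem is the vertex of T labelled c.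
    Conflict : Rel (Fin 4) 0ℓ
    Conflict c x = ∃₂ λ u w → u ∈ S × w ∈ T × Adj G u w × label 4 T w ≡ c × cS u ≡ x

    conflict? : Decidable Conflict
    conflict? c x = any? λ u → any? λ w →
      (u ∈? S) ×-dec (w ∈? T) ×-dec (adj u w ≟ᵇ true) ×-dec (label 4 T w ≟ c) ×-dec (cS u ≟ x)

    module _ (sp : Special G S T) where

      conflict-row : ∣ T ∣ ≤ 4 → ∀ c → AtMostOne (Conflict c)
      conflict-row ∣T∣≤4 c (u , w , u∈S , w∈T , u~w , refl , refl)
                           (u′ , w′ , u′∈S , w′∈T , u′~w′ , w′≡w , refl)
        with label-injective T ∣T∣≤4 w′∈T w∈T w′≡w
      ... | refl = cong cS (proj₂ sp w u u′ w∈T u∈S u′∈S (adj-sym _ _ u~w) (adj-sym _ _ u′~w′))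

      conflict-col : InjectiveOn S cS → ∀ x → AtMostOne (flip Conflict x)
      conflict-col injS x (u , w , u∈S , w∈T , u~w , refl , refl)
                          (u′ , w′ , u′∈S , w′∈T , u′~w′ , refl , u′≡u)
        with injS u′∈S u∈S u′≡u
      ... | refl = cong (label 4 T) (proj₁ sp u w w′ u∈S w∈T w′∈T u~w u′~w′)

    avoids⇒separated : (σ : Permutation′ 4) → Avoids Conflict σ → Separated S T cS (relabel σ T)
    avoids⇒separated σ avoid u∈S w∈T u~w e =
      avoid _ (subst (Conflict _) e (_ , _ , u∈S , w∈T , u~w , refl , refl))

  extend-colouring : ∀ {S T} {cS : Fin n → Fin 4} → InjectiveOn S cS → Special G S T → ∣ T ∣ ≤ 4 →
    Σ[ σ ∈ Permutation′ 4 ] Separated S T cS (relabel σ T)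
  extend-colouring {S} {T} {cS} injS sp ∣T∣≤4 =
    map₂ (λ {σ} → avoids⇒separated S T cS σ) (avoiding-permutation₄ (conflict? S T cS)
      (λ c → atMostOne⇒atMostTwo (conflict-row S T cS sp ∣T∣≤4 c))
      (λ x → atMostOne⇒atMostTwo (conflict-col S T cS sp injS x)))

  extend-colouring₂ : ∀ {S S′ T} {cS cS′ : Fin n → Fin 4} →
    InjectiveOn S cS → InjectiveOn S′ cS′ → Special G S T → Special G S′ T → ∣ T ∣ ≤ 4 →
    Σ[ σ ∈ Permutation′ 4 ] Separated S T cS (relabel σ T) × Separated S′ T cS′ (relabel σ T)
  extend-colouring₂ {S} {S′} {T} {cS} {cS′} injS injS′ sp sp′ ∣T∣≤4 =
    map₂ (λ {σ} avoids → avoids⇒separated S T cS σ (λ i → avoids i ∘ inj₁)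
                       , avoids⇒separated S′ T cS′ σ (λ i → avoids i ∘ inj₂))
      (avoiding-permutation₄ (Union.decidable (conflict? S T cS) (conflict? S′ T cS′))
        (λ c → atMostOne-∪ (conflict-row S T cS sp ∣T∣≤4 c) (conflict-row S′ T cS′ sp′ ∣T∣≤4 c))
        (λ x → atMostOne-∪ (conflict-col S T cS sp injS x) (conflict-col S′ T cS′ sp′ injS′ x)))

  colouring-from-parts : ∀ {k Q₁ Q₂ Q₃} {c₁ c₂ c₃ : Fin n → Fin k} →
    (∀ v → v ∈ Q₁ ⊎ v ∈ Q₂ ⊎ v ∈ Q₃) →
    Separated Q₁ Q₁ c₁ c₁ → Separated Q₂ Q₂ c₂ c₂ → Separated Q₃ Q₃ c₃ c₃ →
    Separated Q₁ Q₂ c₁ c₂ → Separated Q₁ Q₃ c₁ c₃ → Separated Q₂ Q₃ c₂ c₃ → Colorable G k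
  colouring-from-parts {k} {Q₁} {Q₂} {Q₃} {c₁} {c₂} {c₃} cover s₁₁ s₂₂ s₃₃ s₁₂ s₁₃ s₂₃ =
    (λ v → colour (cover v)) , λ u v → proper (cover u) (cover v)
    where
    colour : ∀ {v} → v ∈ Q₁ ⊎ v ∈ Q₂ ⊎ v ∈ Q₃ → Fin k
    colour {v} (inj₁ _)        = c₁ v
    colour {v} (inj₂ (inj₁ _)) = c₂ v
    colour {v} (inj₂ (inj₂ _)) = c₃ v

    proper : ∀ {u v} (u∈ : u ∈ Q₁ ⊎ u ∈ Q₂ ⊎ u ∈ Q₃) (v∈ : v ∈ Q₁ ⊎ v ∈ Q₂ ⊎ v ∈ Q₃) →
      Adj G u v → colour u∈ ≢ colour v∈
    proper (inj₁ u∈)        (inj₁ v∈)        = s₁₁ u∈ v∈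
    proper (inj₁ u∈)        (inj₂ (inj₁ v∈)) = s₁₂ u∈ v∈
    proper (inj₁ u∈)        (inj₂ (inj₂ v∈)) = s₁₃ u∈ v∈
    proper (inj₂ (inj₁ u∈)) (inj₁ v∈)        = separated-sym s₁₂ u∈ v∈
    proper (inj₂ (inj₁ u∈)) (inj₂ (inj₁ v∈)) = s₂₂ u∈ v∈
    proper (inj₂ (inj₁ u∈)) (inj₂ (inj₂ v∈)) = s₂₃ u∈ v∈
    proper (inj₂ (inj₂ u∈)) (inj₁ v∈)        = separated-sym s₁₃ u∈ v∈
    proper (inj₂ (inj₂ u∈)) (inj₂ (inj₁ v∈)) = separated-sym s₂₃ u∈ v∈
    proper (inj₂ (inj₂ u∈)) (inj₂ (inj₂ v∈)) = s₃₃ u∈ v∈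

lemma2p1 : ∀ {n : ℕ} (G : Graph n) → Good G → CliqueNumber G 4 → Colorable G 4
lemma2p1 G (Q₁ , Q₂ , Q₃ , (cover , _) , (K₁ , K₂ , sp₁₂) , (_ , K₃ , sp₂₃) , (_ , _ , sp₃₁))
         (_ , ω≤4) =
  let c₁-injective = label-injective Q₁ (ω≤4 Q₁ K₁)
      σ₂ , sep₁₂ = extend-colouring G c₁-injective sp₁₂ (ω≤4 Q₂ K₂)
      c₂-injective = relabel-injective σ₂ Q₂ (ω≤4 Q₂ K₂)
      σ₃ , sep₁₃ , sep₂₃ =
        extend-colouring₂ G c₁-injective c₂-injective (swap sp₃₁) sp₂₃ (ω≤4 Q₃ K₃)
      c₃-injective = relabel-injective σ₃ Q₃ (ω≤4 Q₃ K₃)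
  in colouring-from-parts G cover
       (injectiveOn⇒separated G c₁-injective)
       (injectiveOn⇒separated G c₂-injective)
       (injectiveOn⇒separated G c₃-injective)
       sep₁₂ sep₁₃ sep₂₃
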